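{- Let $k\ge1$, $n=2k$, and let $a_1,\dots,a_n$ be positive integers with $\max_i a_i/\min_i a_i\le1+\frac1{100k}$ such that no $\mathcal{I}\subseteq[n]$ with $|\mathcal{I}|=k$ satisfies $\sum_{i\in\mathcal{I}}a_i=\frac12\sum_{i=1}^n a_i$. Let $(\mathcal{D},f)$ be the instance constructed from $(a_1,\dots,a_n)$ as described in the context. Then every regular partition $\mathcal{P}$ of $\mathcal{X}$ satisfies $\mathsf{cost}_{\mathcal{D},f}(\mathcal{P})>\frac1{36k}$.
   Context: Construction: let $S=\sum_i a_i$, $\epsilon_i=a_i/S$, $\epsilon=\frac1{6k}$, $\delta=\frac1{4k}$. The domain is $\mathcal{X}=\{x_1,\dots,x_n\}\cup\{x'_1,\dots,x'_n\}\cup\{x''_1,\dots,x''_n\}$ ($3n$ distinct elements); $\mathcal{D}$ over $\mathcal{X}\times\{0,1\}$ has uniform $\mathcal{X}$-marginal $\mathcal{D}_x$ and conditional probabilities $\mu(x)=\Pr[y=1\mid x]$: $\mu(x_i)=\frac12+\epsilon_i$, $\mu(x'_i)=\frac12-\delta$, $\mu(x''_i)=\frac12$; predictor $f(x_i)=f(x'_i)=\frac12$, $f(x''_i)=\frac12+\epsilon$. For nonempty $\mathcal{X}'\subseteq\mathcal{X}$, $\mu(\mathcal{X}')=\Pr[y=1\mid x\in\mathcal{X}']$ and $\mathsf{cost}_{\mathcal{D},f}(\mathcal{X}')=\sum_{x\in\mathcal{X}'}\mathcal{D}_x(x)|f(x)-\mu(\mathcal{X}')|$; the cost of a partition is the sum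 of the costs of its parts. The signature of $\mathcal{X}'$ is $(a,b,c)$ where $a,b,c$ are the numbers of $x$-, $x'$-, $x''$-elements in $\mathcal{X}'$. A partition is regular if every part has signature $(t,2t,0)$ or $(t,0,2t)$ for some integer $t$ (depending on the part). -}

module Defs where

open import Data.Nat as ℕ using (ℕ; zero; suc)
open import Data.Integer using (+_)
open import Data.Fin using (Fin; _≟_)
import Data.Fin
open import Data.Rational using (ℚ; 0ℚ; 1ℚ; ½; _+_; _*_; _-_; ∣_∣; _/_)
open import Relation.Nullary using (yes; no)

ℕtoℚ : ℕ → ℚ
ℕtoℚ m = + m / 1

-- q / d for d : ℕ; conventionally 0 when d = 0 (never used with d = 0 in
-- a way that matters)
divℕ : ℚ → ℕ → ℚ
divℕ q zero = 0ℚ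
divℕ q (suc d) = q * (+ 1 / suc d)

sumℚ : ∀ {m} → (Fin m → ℚ) → ℚ
sumℚ {zero} g = 0ℚ
sumℚ {suc m} g = g Data.Fin.zero + sumℚ (λ i → g (Data.Fin.suc i))

sumℕ : ∀ {m} → (Fin m → ℕ) → ℕ
sumℕ {zero} g = 0
sumℕ {suc m} g = g Data.Fin.zero ℕ.+ sumℕ (λ i → g (Data.Fin.suc i))

data Pt (n : ℕ) : Set where
  px   : Fin n → Pt n
  px′  : Fin n → Pt n
  px″  : Fin n → Pt n

sumPt : ∀ {n} → (Pt n → ℚ) → ℚ
sumPt g = sumℚ (λ i → g (px i)) + (sumℚ (λ i → g (px′ i)) + sumℚ (λ i → g (px″ i)))

-- A partition of 𝒳 into (at most) m parts, given by a labelling lab;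
-- the parts are the nonempty fibres lab⁻¹(j).
-- indicator of membership of x in part j
inPart : ∀ {n m} → (Pt n → Fin m) → Fin m → Pt n → ℕ
inPart lab j x with lab x ≟ j
... | yes _ = 1
... | no  _ = 0

sumPart : ∀ {n m} → (Pt n → Fin m) → Fin m → (Pt n → ℚ) → ℚ
sumPart lab j g = sumPt (λ x → ℕtoℚ (inPart lab j x) * g x)

sizePart : ∀ {n m} → (Pt n → Fin m) → Fin m → ℕ
sizePart {n} lab j =
  sumℕ (λ i → inPart lab j (px i)) ℕ.+
  (sumℕ (λ i → inPart lab j (px′ i)) ℕ.+ sumℕ (λ i → inPart lab j (px″ i)))

module Instance (k : ℕ) (a : Fin (2 ℕ.* k) → ℕ) where
  n : ℕ
  n = 2 ℕ.* k

  S : ℕ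
  S = sumℕ a

  εᵢ : Fin n → ℚ
  εᵢ i = divℕ (ℕtoℚ (a i)) S

  ε : ℚ
  ε = divℕ 1ℚ (6 ℕ.* k)

  δ : ℚ
  δ = divℕ 1ℚ (4 ℕ.* k)

  Dx : Pt n → ℚ
  Dx _ = divℕ 1ℚ (3 ℕ.* n)

  -- μ(x) = Pr[y = 1 | x]
  μ : Pt n → ℚ
  μ (px i)  = ½ + εᵢ i
  μ (px′ i) = ½ - δ
  μ (px″ i) = ½

  f : Pt n → ℚ
  f (px i)  = ½
  f (px′ i) = ½
  f (px″ i) = ½ + ε

  -- μ(𝒳') = Pr[y=1 | x ∈ 𝒳'] = (Σ_{x∈𝒳'} 𝒟_x(x) μ(x)) / (Σ_{x∈𝒳'} 𝒟_x(x))
  -- (uniform marginal: the average of μ over the part)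
  μPart : ∀ {m} → (Pt n → Fin m) → Fin m → ℚ
  μPart lab j = divℕ (sumPart lab j μ) (sizePart lab j)

  costPart : ∀ {m} → (Pt n → Fin m) → Fin m → ℚ
  costPart lab j = sumPart lab j (λ x → Dx x * ∣ f x - μPart lab j ∣)

  -- cost of the partition = sum of costs of its parts (empty fibres contribute 0)
  cost : ∀ {m} → (Pt n → Fin m) → ℚ
  cost lab = sumℚ (costPart lab)

sigA sigB sigC : ∀ {n m} → (Pt n → Fin m) → Fin m → ℕ
sigA lab j = sumℕ (λ i → inPart lab j (px i))
sigB lab j = sumℕ (λ i → inPart lab j (px′ i))
sigC lab j = sumℕ (λ i → inPart lab j (px″ i))

open import Data.Product using (∃; _×_)
open import Data.Sum using (_⊎_)
open import Relation.Binary.PropositionalEquality using (_≡_)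

-- regular: every part has signature (t,2t,0) or (t,0,2t)
-- (an empty fibre has signature (0,0,0), which is of this form with t = 0)
Regular : ∀ {n m} → (Pt n → Fin m) → Set
Regular lab = ∀ j → ∃ λ t →
  (sigA lab j ≡ t × sigB lab j ≡ 2 ℕ.* t × sigC lab j ≡ 0) ⊎
  (sigA lab j ≡ t × sigB lab j ≡ 0 × sigC lab j ≡ 2 ℕ.* t)

open import Data.Fin.Subset using (Subset)
open import Data.Fin.Subset.Properties using (_∈?_)
sumIn : ∀ {n} → Subset n → Fin n → (Fin n → ℕ) → ℕ
sumIn I i a with i ∈? I
... | yes _ = a i
... | no  _ = 0

{-# OPTIONS --safe #-}
-- The bound is certified by LP duality. For a part P with label mean μ(P) and weights w with |w| ≤ 1
-- whose sum over P is σ·|P|, the μ(P)-terms cancel in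
--   Σ_{x∈P} D·(w(x)·f(x) − σ·μ(x)) = Σ_{x∈P} D·w(x)·(f(x) − μ(P)) ≤ cost(P).
-- In a regular partition every x′ lies in a part of signature (t,2t,0) and every x″ in one of
-- signature (t,0,2t); counting the x′ shows that exactly k of the x_i lie in parts of the first kind.
-- Let ρ be their ε-mass. The weights −1 on x_i, −c on x′_i and c on x″_i (|c| ≤ 1) certify
-- cost ≥ D·(1/6 + (4/3)·c·(ρ − 1/2)) with D = 1/(6k). As no k-subset is balanced, ρ ≠ 1/2, and
-- c = ±1 with the sign of ρ − 1/2 gives cost > D/6 = 1/(36k).
module Submission where

open import Defs

module CostLowerBound where

  open import Data.Bool using (Bool; true; false)
  open import Data.Empty using (⊥-elim)
  open import Data.Fin using (Fin; zero; suc)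
  import Data.Fin as F
  open import Data.Integer as ℤ using (+_)
  import Data.Integer.Properties as ℤP
  open import Data.Nat as ℕ using (ℕ; zero; suc; NonZero)
  import Data.Nat.Properties as ℕP
  open import Data.Product using (∃; _×_; _,_; proj₁; proj₂)
  open import Data.Sum using (_⊎_; inj₁; inj₂)
  open import Data.Rational as Q using (ℚ; 0ℚ; 1ℚ; ½; _+_; _*_; _-_; -_; _/_; fromℚᵘ; toℚᵘ)
  import Data.Rational.Properties as QP
  open import Data.Rational.Solver using (module +-*-Solver)
  open import Data.Rational.Unnormalised as U using (ℚᵘ; mkℚᵘ; *≡*)
  import Data.Rational.Unnormalised.Properties as UP
  open import Data.Fin.Subset using (Subset; ∣_∣)
  open import Data.Fin.Subset.Properties using (_∈?_)
  open import Data.Vec using (tabulate)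
  import Data.Vec.Properties as VP
  open import Function using (_∘_)
  open import Relation.Binary.PropositionalEquality
  open import Relation.Binary.Definitions using (Tri; tri<; tri≈; tri>)
  open import Relation.Nullary using (¬_; yes; no; does)
  open import Relation.Nullary.Decidable using (dec-true)
  import Algebra.Properties.Semiring.Sum as SemiringSum
  open import Algebra.Bundles using (Ring)

  open +-*-Solver

  -- Rational arithmetic

  fromℚᵘ-+ : ∀ p q → fromℚᵘ (p U.+ q) ≡ fromℚᵘ p + fromℚᵘ q
  fromℚᵘ-+ p q = QP.toℚᵘ-injective (begin
    toℚᵘ (fromℚᵘ (p U.+ q))              ≈⟨ QP.toℚᵘ-fromℚᵘ (p U.+ q) ⟩
    p U.+ q                              ≈⟨ UP.+-cong (UP.≃-sym (QP.toℚᵘ-fromℚᵘ p)) (UP.≃-sym (QP.toℚᵘ-fromℚᵘ q)) ⟩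
    toℚᵘ (fromℚᵘ p) U.+ toℚᵘ (fromℚᵘ q)  ≈⟨ UP.≃-sym (QP.toℚᵘ-homo-+ (fromℚᵘ p) (fromℚᵘ q)) ⟩
    toℚᵘ (fromℚᵘ p + fromℚᵘ q)           ∎)
    where open UP.≃-Reasoning

  fromℚᵘ-* : ∀ p q → fromℚᵘ (p U.* q) ≡ fromℚᵘ p * fromℚᵘ q
  fromℚᵘ-* p q = QP.toℚᵘ-injective (begin
    toℚᵘ (fromℚᵘ (p U.* q))              ≈⟨ QP.toℚᵘ-fromℚᵘ (p U.* q) ⟩
    p U.* q                              ≈⟨ UP.*-cong (UP.≃-sym (QP.toℚᵘ-fromℚᵘ p)) (UP.≃-sym (QP.toℚᵘ-fromℚᵘ q)) ⟩
    toℚᵘ (fromℚᵘ p) U.* toℚᵘ (fromℚᵘ q)  ≈⟨ UP.≃-sym (QP.toℚᵘ-homo-* (fromℚᵘ p) (fromℚᵘ q)) ⟩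
    toℚᵘ (fromℚᵘ p * fromℚᵘ q)           ∎)
    where open UP.≃-Reasoning

  ℕtoℚ-+ : ∀ m n → ℕtoℚ (m ℕ.+ n) ≡ ℕtoℚ m + ℕtoℚ n
  ℕtoℚ-+ m n = trans (QP.fromℚᵘ-cong {mkℚᵘ (+ (m ℕ.+ n)) 0} {mkℚᵘ (+ m) 0 U.+ mkℚᵘ (+ n) 0} (*≡* eq))
                     (fromℚᵘ-+ (mkℚᵘ (+ m) 0) (mkℚᵘ (+ n) 0))
    where
    eq : + (m ℕ.+ n) ℤ.* + 1 ≡ (+ m ℤ.* + 1 ℤ.+ + n ℤ.* + 1) ℤ.* + 1
    eq rewrite ℤP.*-identityʳ (+ m) | ℤP.*-identityʳ (+ n) = cong (ℤ._* + 1) (ℤP.pos-+ m n)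

  ℕtoℚ-* : ∀ m n → ℕtoℚ (m ℕ.* n) ≡ ℕtoℚ m * ℕtoℚ n
  ℕtoℚ-* m n = trans (QP.fromℚᵘ-cong {mkℚᵘ (+ (m ℕ.* n)) 0} {mkℚᵘ (+ m) 0 U.* mkℚᵘ (+ n) 0} (*≡* eq))
                     (fromℚᵘ-* (mkℚᵘ (+ m) 0) (mkℚᵘ (+ n) 0))
    where
    eq : + (m ℕ.* n) ℤ.* + 1 ≡ (+ m ℤ.* + n) ℤ.* + 1
    eq = cong (ℤ._* + 1) (ℤP.pos-* m n)

  ℕtoℚ-injective : ∀ {m n} → ℕtoℚ m ≡ ℕtoℚ n → m ≡ n
  ℕtoℚ-injective {m} {n} eq with UP.≃-trans (UP.≃-sym (QP.toℚᵘ-fromℚᵘ (mkℚᵘ (+ m) 0)))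
                                  (UP.≃-trans (QP.toℚᵘ-cong eq) (QP.toℚᵘ-fromℚᵘ (mkℚᵘ (+ n) 0)))
  ... | *≡* m*1≡n*1 = ℤP.+-injective (ℤP.*-cancelʳ-≡ (+ m) (+ n) (+ 1) m*1≡n*1)

  ℕtoℚ-*-divℕ : ∀ q d .{{_ : NonZero d}} → ℕtoℚ d * divℕ q d ≡ q
  ℕtoℚ-*-divℕ q (suc d) = begin
    ℕtoℚ (suc d) * (q * (+ 1 / suc d))   ≡⟨ solve 3 (λ x q y → x :* (q :* y) := q :* (x :* y)) refl
                                              (ℕtoℚ (suc d)) q (+ 1 / suc d) ⟩
    q * (ℕtoℚ (suc d) * (+ 1 / suc d))   ≡⟨ cong (q *_) (trans (sym (fromℚᵘ-* d′ 1/d′)) (QP.fromℚᵘ-cong (UP.*-inverseʳ d′))) ⟩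
    q * 1ℚ                               ≡⟨ QP.*-identityʳ q ⟩
    q                                    ∎
    where
    open ≡-Reasoning
    d′ 1/d′ : ℚᵘ
    d′ = mkℚᵘ (+ suc d) 0
    1/d′ = mkℚᵘ (+ 1) d

  divℕ-* : ∀ q m d .{{_ : NonZero m}} .{{_ : NonZero d}} → divℕ q (m ℕ.* d) ≡ divℕ (divℕ q m) d
  divℕ-* q (suc m) (suc d) = trans (cong (q *_) (fromℚᵘ-* (mkℚᵘ (+ 1) m) (mkℚᵘ (+ 1) d)))
                                   (sym (QP.*-assoc q (+ 1 / suc m) (+ 1 / suc d)))

  divℕ-as-* : ∀ q d → divℕ q d ≡ q * divℕ 1ℚ d
  divℕ-as-* q zero = sym (QP.*-zeroʳ q)
  divℕ-as-* q (suc d) = cong (q *_) (sym (QP.*-identityˡ (+ 1 / suc d)))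

  *-divℕ : ∀ p q d → p * divℕ q d ≡ divℕ (p * q) d
  *-divℕ p q d = trans (cong (p *_) (divℕ-as-* q d))
                       (trans (sym (QP.*-assoc p q (divℕ 1ℚ d))) (sym (divℕ-as-* (p * q) d)))

  divℕ-self : ∀ d .{{_ : NonZero d}} → divℕ (ℕtoℚ d) d ≡ 1ℚ
  divℕ-self d = trans (divℕ-as-* (ℕtoℚ d) d) (ℕtoℚ-*-divℕ 1ℚ d)

  ℕtoℚ-*-divℕ-* : ∀ q m d .{{_ : NonZero m}} .{{_ : NonZero d}} → ℕtoℚ d * divℕ q (m ℕ.* d) ≡ divℕ q m
  ℕtoℚ-*-divℕ-* q m d = trans (cong (ℕtoℚ d *_) (divℕ-* q m d)) (ℕtoℚ-*-divℕ (divℕ q m) d)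

  divℕ-nonNeg : ∀ q d .{{_ : Q.NonNegative q}} → Q.NonNegative (divℕ q d)
  divℕ-nonNeg q zero = _
  divℕ-nonNeg q (suc d) = QP.nonNeg*nonNeg⇒nonNeg q (+ 1 / suc d) {{QP.normalize-nonNeg 1 (suc d)}}

  divℕ-pos : ∀ q d .{{_ : Q.Positive q}} .{{_ : NonZero d}} → Q.Positive (divℕ q d)
  divℕ-pos q (suc d) = QP.pos*pos⇒pos q (+ 1 / suc d) {{QP.normalize-pos 1 (suc d)}}

  p≤∣p∣ : ∀ p → p Q.≤ Q.∣ p ∣
  p≤∣p∣ p with QP.∣p∣≡p∨∣p∣≡-p p
  ... | inj₁ ∣p∣≡p = QP.≤-reflexive (sym ∣p∣≡p)
  ... | inj₂ ∣p∣≡-p = begin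
    p          ≡⟨ solve 1 (λ p → p := :- (:- p)) refl p ⟩
    - (- p)    ≡⟨ cong -_ (sym ∣p∣≡-p) ⟩
    - Q.∣ p ∣  ≤⟨ QP.neg-antimono-≤ (QP.0≤∣p∣ p) ⟩
    0ℚ         ≤⟨ QP.0≤∣p∣ p ⟩
    Q.∣ p ∣    ∎
    where open QP.≤-Reasoning

  *-≤-∣∣ : ∀ w z → Q.∣ w ∣ Q.≤ 1ℚ → w * z Q.≤ Q.∣ z ∣
  *-≤-∣∣ w z ∣w∣≤1 = begin
    w * z              ≤⟨ p≤∣p∣ (w * z) ⟩
    Q.∣ w * z ∣        ≡⟨ QP.∣p*q∣≡∣p∣*∣q∣ w z ⟩
    Q.∣ w ∣ * Q.∣ z ∣  ≤⟨ QP.*-monoʳ-≤-nonNeg Q.∣ z ∣ {{QP.∣-∣-nonNeg z}} ∣w∣≤1 ⟩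
    1ℚ * Q.∣ z ∣       ≡⟨ QP.*-identityˡ Q.∣ z ∣ ⟩
    Q.∣ z ∣            ∎
    where open QP.≤-Reasoning

  0<q-p : ∀ {p q} → p Q.< q → 0ℚ Q.< q - p
  0<q-p {p} {q} p<q = subst (Q._< q - p) (QP.+-inverseʳ p) (QP.+-monoˡ-< (- p) p<q)

  -- Finite sums

  module ℚΣ = SemiringSum (Ring.semiring QP.+-*-ring)

  sumℚ≡sum : ∀ {m} (g : Fin m → ℚ) → sumℚ g ≡ ℚΣ.sum g
  sumℚ≡sum {zero} g = refl
  sumℚ≡sum {suc m} g = cong (_+_ (g zero)) (sumℚ≡sum (g ∘ suc))

  sumℚ-cong : ∀ {m} {g h : Fin m → ℚ} → (∀ i → g i ≡ h i) → sumℚ g ≡ sumℚ h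
  sumℚ-cong {g = g} {h} g≗h rewrite sumℚ≡sum g | sumℚ≡sum h = ℚΣ.sum-cong-≗ g≗h

  sumℚ-+ : ∀ {m} (g h : Fin m → ℚ) → sumℚ (λ i → g i + h i) ≡ sumℚ g + sumℚ h
  sumℚ-+ g h rewrite sumℚ≡sum g | sumℚ≡sum h | sumℚ≡sum (λ i → g i + h i) = ℚΣ.∑-distrib-+ g h

  sumℚ-*ˡ : ∀ {m} q (g : Fin m → ℚ) → sumℚ (λ i → q * g i) ≡ q * sumℚ g
  sumℚ-*ˡ q g rewrite sumℚ≡sum g | sumℚ≡sum (λ i → q * g i) = sym (ℚΣ.*-distribˡ-sum q g)

  sumℚ-comm : ∀ {m p} (g : Fin m → Fin p → ℚ) →
    sumℚ (λ j → sumℚ (g j)) ≡ sumℚ (λ i → sumℚ (λ j → g j i))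
  sumℚ-comm {m} {p} g = begin
    sumℚ (λ j → sumℚ (g j))                  ≡⟨ sumℚ-cong (λ j → sumℚ≡sum (g j)) ⟩
    sumℚ (λ j → ℚΣ.sum (g j))                ≡⟨ sumℚ≡sum (λ j → ℚΣ.sum (g j)) ⟩
    ℚΣ.sum (λ j → ℚΣ.sum (g j))              ≡⟨ ℚΣ.∑-comm g ⟩
    ℚΣ.sum (λ i → ℚΣ.sum (λ j → g j i))      ≡⟨ sym (sumℚ≡sum (λ i → ℚΣ.sum (λ j → g j i))) ⟩
    sumℚ (λ i → ℚΣ.sum (λ j → g j i))        ≡⟨ sumℚ-cong (λ i → sym (sumℚ≡sum (λ j → g j i))) ⟩
    sumℚ (λ i → sumℚ (λ j → g j i))          ∎
    where open ≡-Reasoning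

  sumℚ-mono-≤ : ∀ {m} {g h : Fin m → ℚ} → (∀ i → g i Q.≤ h i) → sumℚ g Q.≤ sumℚ h
  sumℚ-mono-≤ {zero} g≤h = QP.≤-refl
  sumℚ-mono-≤ {suc m} g≤h = QP.+-mono-≤ (g≤h zero) (sumℚ-mono-≤ (g≤h ∘ suc))

  sumℚ-const : ∀ {m} q → sumℚ {m} (λ _ → q) ≡ ℕtoℚ m * q
  sumℚ-const {zero} q = sym (QP.*-zeroˡ q)
  sumℚ-const {suc m} q = begin
    q + sumℚ {m} (λ _ → q)    ≡⟨ cong (_+_ q) (sumℚ-const {m} q) ⟩
    q + ℕtoℚ m * q            ≡⟨ solve 2 (λ q M → q :+ M :* q := (con 1ℚ :+ M) :* q) refl q (ℕtoℚ m) ⟩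
    (1ℚ + ℕtoℚ m) * q         ≡⟨ cong (_* q) (sym (ℕtoℚ-+ 1 m)) ⟩
    ℕtoℚ (suc m) * q          ∎
    where open ≡-Reasoning

  sumℚ-minus : ∀ {m} (g h : Fin m → ℚ) → sumℚ (λ i → g i - h i) ≡ sumℚ g - sumℚ h
  sumℚ-minus g h = begin
    sumℚ (λ i → g i - h i)             ≡⟨ sumℚ-cong (λ i → negate (g i) (h i)) ⟩
    sumℚ (λ i → g i + - 1ℚ * h i)      ≡⟨ sumℚ-+ g (λ i → - 1ℚ * h i) ⟩
    sumℚ g + sumℚ (λ i → - 1ℚ * h i)   ≡⟨ cong (_+_ (sumℚ g)) (sumℚ-*ˡ (- 1ℚ) h) ⟩
    sumℚ g + - 1ℚ * sumℚ h             ≡⟨ sym (negate (sumℚ g) (sumℚ h)) ⟩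
    sumℚ g - sumℚ h                    ∎
    where
    open ≡-Reasoning
    negate : ∀ x y → x - y ≡ x + - 1ℚ * y
    negate = solve 2 (λ x y → x :- y := x :+ con (- 1ℚ) :* y) refl

  sumℚ-ℕtoℚ : ∀ {m} (g : Fin m → ℕ) → sumℚ (ℕtoℚ ∘ g) ≡ ℕtoℚ (sumℕ g)
  sumℚ-ℕtoℚ {zero} g = refl
  sumℚ-ℕtoℚ {suc m} g = trans (cong (_+_ (ℕtoℚ (g zero))) (sumℚ-ℕtoℚ (g ∘ suc)))
                              (sym (ℕtoℚ-+ (g zero) (sumℕ (g ∘ suc))))

  sumℚ-ℕtoℚ-* : ∀ {m} (g : Fin m → ℕ) q → sumℚ (λ i → ℕtoℚ (g i) * q) ≡ ℕtoℚ (sumℕ g) * q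
  sumℚ-ℕtoℚ-* g q = begin
    sumℚ (λ i → ℕtoℚ (g i) * q)   ≡⟨ sumℚ-cong (λ i → QP.*-comm (ℕtoℚ (g i)) q) ⟩
    sumℚ (λ i → q * ℕtoℚ (g i))   ≡⟨ sumℚ-*ˡ q (ℕtoℚ ∘ g) ⟩
    q * sumℚ (ℕtoℚ ∘ g)           ≡⟨ cong (q *_) (sumℚ-ℕtoℚ g) ⟩
    q * ℕtoℚ (sumℕ g)             ≡⟨ QP.*-comm q (ℕtoℚ (sumℕ g)) ⟩
    ℕtoℚ (sumℕ g) * q             ∎
    where open ≡-Reasoning

  sumℚ-divℕ : ∀ {m} (g : Fin m → ℚ) d → sumℚ (λ i → divℕ (g i) d) ≡ divℕ (sumℚ g) d
  sumℚ-divℕ g d = begin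
    sumℚ (λ i → divℕ (g i) d)         ≡⟨ sumℚ-cong (λ i → divℕ-as-* (g i) d) ⟩
    sumℚ (λ i → g i * divℕ 1ℚ d)      ≡⟨ sumℚ-cong (λ i → QP.*-comm (g i) (divℕ 1ℚ d)) ⟩
    sumℚ (λ i → divℕ 1ℚ d * g i)      ≡⟨ sumℚ-*ˡ (divℕ 1ℚ d) g ⟩
    divℕ 1ℚ d * sumℚ g                ≡⟨ QP.*-comm (divℕ 1ℚ d) (sumℚ g) ⟩
    sumℚ g * divℕ 1ℚ d                ≡⟨ sym (divℕ-as-* (sumℚ g) d) ⟩
    divℕ (sumℚ g) d                   ∎
    where open ≡-Reasoning

  sumℚ-vanishing : ∀ {m} (ι : Fin m → ℕ) (g : Fin m → ℚ) → (∀ i → ι i ≡ 0) →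
    sumℚ (λ i → ℕtoℚ (ι i) * g i) ≡ 0ℚ
  sumℚ-vanishing {m} ι g ι≡0 = begin
    sumℚ (λ i → ℕtoℚ (ι i) * g i)   ≡⟨ sumℚ-cong (λ i → cong (λ k → ℕtoℚ k * g i) (ι≡0 i)) ⟩
    sumℚ {m} (λ i → 0ℚ * g i)       ≡⟨ sumℚ-cong (λ i → QP.*-zeroˡ (g i)) ⟩
    sumℚ {m} (λ _ → 0ℚ)             ≡⟨ sumℚ-const {m} 0ℚ ⟩
    ℕtoℚ m * 0ℚ                     ≡⟨ QP.*-zeroʳ (ℕtoℚ m) ⟩
    0ℚ                              ∎
    where open ≡-Reasoning

  𝟙 : Bool → ℕ
  𝟙 true = 1
  𝟙 false = 0

  sumℚ-indicator : ∀ {m} (l : Fin m) (h : Fin m → ℚ) → sumℚ (λ j → ℕtoℚ (𝟙 (does (l F.≟ j))) * h j) ≡ h l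
  sumℚ-indicator zero h = begin
    1ℚ * h zero + sumℚ (λ j → 0ℚ * h (suc j))  ≡⟨ cong₂ _+_ (QP.*-identityˡ (h zero)) (sumℚ-*ˡ 0ℚ (h ∘ suc)) ⟩
    h zero + 0ℚ * sumℚ (h ∘ suc)               ≡⟨ cong (_+_ (h zero)) (QP.*-zeroˡ (sumℚ (h ∘ suc))) ⟩
    h zero + 0ℚ                                ≡⟨ QP.+-identityʳ (h zero) ⟩
    h zero                                     ∎
    where open ≡-Reasoning
  sumℚ-indicator (suc l) h = begin
    0ℚ * h zero + sumℚ (λ j → ℕtoℚ (𝟙 (does (l F.≟ j))) * h (suc j))
      ≡⟨ cong₂ _+_ (QP.*-zeroˡ (h zero)) (sumℚ-indicator l (h ∘ suc)) ⟩
    0ℚ + h (suc l)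
      ≡⟨ QP.+-identityˡ (h (suc l)) ⟩
    h (suc l)
      ∎
    where open ≡-Reasoning

  sum-select : ∀ {m} (b : Fin m → Bool) (u : Bool → ℚ) (h : Fin m → ℚ) →
    sumℚ (λ i → u (b i) * h i) ≡ u false * sumℚ h + (u true - u false) * sumℚ (λ i → ℕtoℚ (𝟙 (b i)) * h i)
  sum-select b u h = begin
    sumℚ (λ i → u (b i) * h i)
      ≡⟨ sumℚ-cong (λ i → select (b i) (h i)) ⟩
    sumℚ (λ i → u false * h i + (u true - u false) * (ℕtoℚ (𝟙 (b i)) * h i))
      ≡⟨ sumℚ-+ (λ i → u false * h i) (λ i → (u true - u false) * (ℕtoℚ (𝟙 (b i)) * h i)) ⟩
    sumℚ (λ i → u false * h i) + sumℚ (λ i → (u true - u false) * (ℕtoℚ (𝟙 (b i)) * h i))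
      ≡⟨ cong₂ _+_ (sumℚ-*ˡ (u false) h) (sumℚ-*ˡ (u true - u false) (λ i → ℕtoℚ (𝟙 (b i)) * h i)) ⟩
    u false * sumℚ h + (u true - u false) * sumℚ (λ i → ℕtoℚ (𝟙 (b i)) * h i)
      ∎
    where
    open ≡-Reasoning
    select : ∀ s z → u s * z ≡ u false * z + (u true - u false) * (ℕtoℚ (𝟙 s) * z)
    select true z = solve 3 (λ t f z → t :* z := f :* z :+ (t :- f) :* (con 1ℚ :* z)) refl (u true) (u false) z
    select false z = solve 3 (λ t f z → f :* z := f :* z :+ (t :- f) :* (con 0ℚ :* z)) refl (u true) (u false) z

  sumℕ-≡0 : ∀ {m} (g : Fin m → ℕ) → sumℕ g ≡ 0 → ∀ i → g i ≡ 0
  sumℕ-≡0 g Σg≡0 zero = ℕP.m+n≡0⇒m≡0 (g zero) Σg≡0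
  sumℕ-≡0 g Σg≡0 (suc i) = sumℕ-≡0 (g ∘ suc) (ℕP.m+n≡0⇒n≡0 (g zero) Σg≡0) i

  ≤-sumℕ : ∀ {m} (g : Fin m → ℕ) i → g i ℕ.≤ sumℕ g
  ≤-sumℕ g zero = ℕP.m≤m+n (g zero) (sumℕ (g ∘ suc))
  ≤-sumℕ g (suc i) = ℕP.≤-trans (≤-sumℕ (g ∘ suc) i) (ℕP.m≤n+m (sumℕ (g ∘ suc)) (g zero))

  sumℕ-nonZero : ∀ {m} (g : Fin (suc m) → ℕ) → 0 ℕ.< g zero → NonZero (sumℕ g)
  sumℕ-nonZero g 0<g₀ = ℕ.>-nonZero (ℕP.<-≤-trans 0<g₀ (≤-sumℕ g zero))

  ∣tabulate∣ : ∀ {p} (g : Fin p → Bool) → ∣ tabulate g ∣ ≡ sumℕ (𝟙 ∘ g)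
  ∣tabulate∣ {zero} g = refl
  ∣tabulate∣ {suc p} g with g zero
  ... | true = cong suc (∣tabulate∣ (g ∘ suc))
  ... | false = ∣tabulate∣ (g ∘ suc)

  sumIn-tabulate : ∀ {p} (g : Fin p → Bool) (a : Fin p → ℕ) i → sumIn (tabulate g) i a ≡ 𝟙 (g i) ℕ.* a i
  sumIn-tabulate g a i with i ∈? tabulate g
  ... | yes i∈I rewrite trans (sym (VP.lookup∘tabulate g i)) (VP.[]=⇒lookup i∈I) =
    sym (ℕP.+-identityʳ (a i))
  ... | no i∉I with g i in gi≡
  ...   | true = ⊥-elim (i∉I (VP.lookup⇒[]= i (tabulate g) (trans (VP.lookup∘tabulate g i) gi≡)))
  ...   | false = refl

  -- Sums over the domain and over parts

  module _ {n : ℕ} where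

    sumPt-cong : {g h : Pt n → ℚ} → (∀ x → g x ≡ h x) → sumPt g ≡ sumPt h
    sumPt-cong g≗h =
      cong₂ _+_ (sumℚ-cong (g≗h ∘ px)) (cong₂ _+_ (sumℚ-cong (g≗h ∘ px′)) (sumℚ-cong (g≗h ∘ px″)))

    sumPt-+ : (g h : Pt n → ℚ) → sumPt (λ x → g x + h x) ≡ sumPt g + sumPt h
    sumPt-+ g h
      rewrite sumℚ-+ (g ∘ px) (h ∘ px) | sumℚ-+ (g ∘ px′) (h ∘ px′) | sumℚ-+ (g ∘ px″) (h ∘ px″) =
      solve 6 (λ a a′ b b′ c c′ → (a :+ a′) :+ ((b :+ b′) :+ (c :+ c′))
                               := (a :+ (b :+ c)) :+ (a′ :+ (b′ :+ c′))) refl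
        (sumℚ (g ∘ px)) (sumℚ (h ∘ px)) (sumℚ (g ∘ px′)) (sumℚ (h ∘ px′)) (sumℚ (g ∘ px″)) (sumℚ (h ∘ px″))

    sumPt-*ˡ : ∀ q (g : Pt n → ℚ) → sumPt (λ x → q * g x) ≡ q * sumPt g
    sumPt-*ˡ q g rewrite sumℚ-*ˡ q (g ∘ px) | sumℚ-*ˡ q (g ∘ px′) | sumℚ-*ˡ q (g ∘ px″) =
      solve 4 (λ q a b c → q :* a :+ (q :* b :+ q :* c) := q :* (a :+ (b :+ c))) refl
        q (sumℚ (g ∘ px)) (sumℚ (g ∘ px′)) (sumℚ (g ∘ px″))

    sumPt-mono-≤ : {g h : Pt n → ℚ} → (∀ x → g x Q.≤ h x) → sumPt g Q.≤ sumPt h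
    sumPt-mono-≤ g≤h =
      QP.+-mono-≤ (sumℚ-mono-≤ (g≤h ∘ px)) (QP.+-mono-≤ (sumℚ-mono-≤ (g≤h ∘ px′)) (sumℚ-mono-≤ (g≤h ∘ px″)))

    sumℚ-sumPt-comm : ∀ {m} (g : Fin m → Pt n → ℚ) →
      sumℚ (λ j → sumPt (g j)) ≡ sumPt (λ x → sumℚ (λ j → g j x))
    sumℚ-sumPt-comm g = begin
      sumℚ (λ j → sumPt (g j))
        ≡⟨ sumℚ-+ (λ j → sumℚ (g j ∘ px)) (λ j → sumℚ (g j ∘ px′) + sumℚ (g j ∘ px″)) ⟩
      sumℚ (λ j → sumℚ (g j ∘ px)) + sumℚ (λ j → sumℚ (g j ∘ px′) + sumℚ (g j ∘ px″))
        ≡⟨ cong (_+_ (sumℚ (λ j → sumℚ (g j ∘ px)))) (sumℚ-+ (λ j → sumℚ (g j ∘ px′)) (λ j → sumℚ (g j ∘ px″))) ⟩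
      sumℚ (λ j → sumℚ (g j ∘ px)) + (sumℚ (λ j → sumℚ (g j ∘ px′)) + sumℚ (λ j → sumℚ (g j ∘ px″)))
        ≡⟨ cong₂ _+_ (sumℚ-comm (λ j → g j ∘ px))
                     (cong₂ _+_ (sumℚ-comm (λ j → g j ∘ px′)) (sumℚ-comm (λ j → g j ∘ px″))) ⟩
      sumPt (λ x → sumℚ (λ j → g j x))
        ∎
      where open ≡-Reasoning

    byKind : ℚ → ℚ → ℚ → Pt n → ℚ
    byKind α β γ (px _) = α
    byKind α β γ (px′ _) = β
    byKind α β γ (px″ _) = γ

  module _ {n m : ℕ} (lab : Pt n → Fin m) where

    inPart-indicator : ∀ j x → inPart lab j x ≡ 𝟙 (does (lab x F.≟ j))
    inPart-indicator j x with lab x F.≟ j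
    ... | yes _ = refl
    ... | no _ = refl

    sum-sumPart : (H : Fin m → Pt n → ℚ) → sumℚ (λ j → sumPart lab j (H j)) ≡ sumPt (λ x → H (lab x) x)
    sum-sumPart H = begin
      sumℚ (λ j → sumPart lab j (H j))
        ≡⟨ sumℚ-sumPt-comm (λ j x → ℕtoℚ (inPart lab j x) * H j x) ⟩
      sumPt (λ x → sumℚ (λ j → ℕtoℚ (inPart lab j x) * H j x))
        ≡⟨ sumPt-cong (λ x → sumℚ-cong (λ j → cong (λ b → ℕtoℚ b * H j x) (inPart-indicator j x))) ⟩
      sumPt (λ x → sumℚ (λ j → ℕtoℚ (𝟙 (does (lab x F.≟ j))) * H j x))
        ≡⟨ sumPt-cong (λ x → sumℚ-indicator (lab x) (λ j → H j x)) ⟩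
      sumPt (λ x → H (lab x) x)
        ∎
      where open ≡-Reasoning

    module _ (j : Fin m) where

      sumPart-cong : {g h : Pt n → ℚ} → (∀ x → g x ≡ h x) → sumPart lab j g ≡ sumPart lab j h
      sumPart-cong g≗h = sumPt-cong (λ x → cong (ℕtoℚ (inPart lab j x) *_) (g≗h x))

      sumPart-+ : (g h : Pt n → ℚ) → sumPart lab j (λ x → g x + h x) ≡ sumPart lab j g + sumPart lab j h
      sumPart-+ g h = trans (sumPt-cong (λ x → QP.*-distribˡ-+ (ℕtoℚ (inPart lab j x)) (g x) (h x)))
                            (sumPt-+ (λ x → ℕtoℚ (inPart lab j x) * g x) (λ x → ℕtoℚ (inPart lab j x) * h x))

      sumPart-*ˡ : ∀ q (g : Pt n → ℚ) → sumPart lab j (λ x → q * g x) ≡ q * sumPart lab j g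
      sumPart-*ˡ q g = trans (sumPt-cong (λ x → swap (ℕtoℚ (inPart lab j x)) q (g x)))
                             (sumPt-*ˡ q (λ x → ℕtoℚ (inPart lab j x) * g x))
        where
        swap : ∀ ι q g → ι * (q * g) ≡ q * (ι * g)
        swap = solve 3 (λ ι q g → ι :* (q :* g) := q :* (ι :* g)) refl

      sumPart-mono-≤ : {g h : Pt n → ℚ} → (∀ x → g x Q.≤ h x) → sumPart lab j g Q.≤ sumPart lab j h
      sumPart-mono-≤ g≤h = sumPt-mono-≤ (λ x →
        QP.*-monoˡ-≤-nonNeg (ℕtoℚ (inPart lab j x)) {{QP.normalize-nonNeg (inPart lab j x) 1}} (g≤h x))

      sumPart-byKind : ∀ α β γ → sumPart lab j (byKind α β γ) ≡
        ℕtoℚ (sigA lab j) * α + (ℕtoℚ (sigB lab j) * β + ℕtoℚ (sigC lab j) * γ)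
      sumPart-byKind α β γ = cong₂ _+_ (sumℚ-ℕtoℚ-* (λ i → inPart lab j (px i)) α)
        (cong₂ _+_ (sumℚ-ℕtoℚ-* (λ i → inPart lab j (px′ i)) β) (sumℚ-ℕtoℚ-* (λ i → inPart lab j (px″ i)) γ))

      sumPart-empty : sizePart lab j ≡ 0 → ∀ g → sumPart lab j g ≡ 0ℚ
      sumPart-empty size≡0 g = begin
        sumPart lab j g   ≡⟨ cong₂ _+_ (vanish px A≡0) (cong₂ _+_ (vanish px′ B≡0) (vanish px″ C≡0)) ⟩
        0ℚ + (0ℚ + 0ℚ)    ≡⟨⟩
        0ℚ                ∎
        where
        open ≡-Reasoning
        A≡0 : sigA lab j ≡ 0
        A≡0 = ℕP.m+n≡0⇒m≡0 (sigA lab j) size≡0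
        B+C≡0 : sigB lab j ℕ.+ sigC lab j ≡ 0
        B+C≡0 = ℕP.m+n≡0⇒n≡0 (sigA lab j) size≡0
        B≡0 : sigB lab j ≡ 0
        B≡0 = ℕP.m+n≡0⇒m≡0 (sigB lab j) B+C≡0
        C≡0 : sigC lab j ≡ 0
        C≡0 = ℕP.m+n≡0⇒n≡0 (sigB lab j) B+C≡0
        vanish : (kind : Fin n → Pt n) → sumℕ (λ i → inPart lab j (kind i)) ≡ 0 →
          sumℚ (λ i → ℕtoℚ (inPart lab j (kind i)) * g (kind i)) ≡ 0ℚ
        vanish kind Σ≡0 = sumℚ-vanishing (λ i → inPart lab j (kind i)) (g ∘ kind) (sumℕ-≡0 _ Σ≡0)

      mean : (Pt n → ℚ) → ℚ
      mean g = divℕ (sumPart lab j g) (sizePart lab j)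

      size*mean : ∀ g → ℕtoℚ (sizePart lab j) * mean g ≡ sumPart lab j g
      size*mean g with sizePart lab j in size≡
      ... | zero = sym (sumPart-empty size≡ g)
      ... | suc s = ℕtoℚ-*-divℕ (sumPart lab j g) (suc s)

      weighted≤deviation : (D : ℚ) .{{_ : Q.NonNegative D}} (w h g : Pt n → ℚ) (σ : ℚ) →
        (∀ x → Q.∣ w x ∣ Q.≤ 1ℚ) → sumPart lab j w ≡ σ * ℕtoℚ (sizePart lab j) →
        sumPart lab j (λ x → D * (w x * h x - σ * g x)) Q.≤ sumPart lab j (λ x → D * Q.∣ h x - mean g ∣)
      weighted≤deviation D w h g σ ∣w∣≤1 Σw≡σN = begin
        sumPart lab j (λ x → D * (w x * h x - σ * g x))
          ≡⟨ sumPart-cong (λ x → solve 6 (λ D w h g σ M →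
               D :* (w :* h :- σ :* g) := D :* (w :* (h :- M)) :+ ((D :* M) :* w :+ (:- (D :* σ)) :* g)) refl
               D (w x) (h x) (g x) σ M) ⟩
        sumPart lab j (λ x → D * (w x * (h x - M)) + ((D * M) * w x + (- (D * σ)) * g x))
          ≡⟨ trans (sumPart-+ (λ x → D * (w x * (h x - M))) (λ x → (D * M) * w x + (- (D * σ)) * g x))
                   (cong (_+_ (sumPart lab j (λ x → D * (w x * (h x - M)))))
                         (trans (sumPart-+ (λ x → (D * M) * w x) (λ x → (- (D * σ)) * g x))
                                (cong₂ _+_ (sumPart-*ˡ (D * M) w) (sumPart-*ˡ (- (D * σ)) g)))) ⟩
        sumPart lab j (λ x → D * (w x * (h x - M)))
          + ((D * M) * sumPart lab j w + (- (D * σ)) * sumPart lab j g)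
          ≡⟨ cong (_+_ (sumPart lab j (λ x → D * (w x * (h x - M))))) mean-cancels ⟩
        sumPart lab j (λ x → D * (w x * (h x - M))) + 0ℚ
          ≡⟨ QP.+-identityʳ _ ⟩
        sumPart lab j (λ x → D * (w x * (h x - M)))
          ≤⟨ sumPart-mono-≤ (λ x → QP.*-monoˡ-≤-nonNeg D (*-≤-∣∣ (w x) (h x - M) (∣w∣≤1 x))) ⟩
        sumPart lab j (λ x → D * Q.∣ h x - M ∣)
          ∎
        where
        open QP.≤-Reasoning
        M N : ℚ
        M = mean g
        N = ℕtoℚ (sizePart lab j)
        mean-cancels : (D * M) * sumPart lab j w + (- (D * σ)) * sumPart lab j g ≡ 0ℚ
        mean-cancels = trans (cong₂ (λ Σw Σg → (D * M) * Σw + (- (D * σ)) * Σg) Σw≡σN (sym (size*mean g)))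
          (solve 4 (λ D M σ N → (D :* M) :* (σ :* N) :+ (:- (D :* σ)) :* (N :* M) := con 0ℚ) refl D M σ N)

    sum-partCount : (kind : Fin n → Pt n) (h : Fin m → ℚ) →
      sumℚ (λ j → ℕtoℚ (sumℕ (λ i → inPart lab j (kind i))) * h j) ≡ sumℚ (λ i → h (lab (kind i)))
    sum-partCount kind h = begin
      sumℚ (λ j → ℕtoℚ (sumℕ (λ i → inPart lab j (kind i))) * h j)
        ≡⟨ sumℚ-cong (λ j → sym (sumℚ-ℕtoℚ-* (λ i → inPart lab j (kind i)) (h j))) ⟩
      sumℚ (λ j → sumℚ (λ i → ℕtoℚ (inPart lab j (kind i)) * h j))
        ≡⟨ sumℚ-comm (λ j i → ℕtoℚ (inPart lab j (kind i)) * h j) ⟩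
      sumℚ (λ i → sumℚ (λ j → ℕtoℚ (inPart lab j (kind i)) * h j))
        ≡⟨ sumℚ-cong (λ i → sumℚ-cong (λ j → cong (λ b → ℕtoℚ b * h j) (inPart-indicator j (kind i)))) ⟩
      sumℚ (λ i → sumℚ (λ j → ℕtoℚ (𝟙 (does (lab (kind i) F.≟ j))) * h j))
        ≡⟨ sumℚ-cong (λ i → sumℚ-indicator (lab (kind i)) h) ⟩
      sumℚ (λ i → h (lab (kind i)))
        ∎
      where open ≡-Reasoning

    inPart-own : ∀ x → inPart lab (lab x) x ≡ 1
    inPart-own x = trans (inPart-indicator (lab x) x) (cong 𝟙 (dec-true (lab x F.≟ lab x) refl))

    0<count-in-own-part : (kind : Fin n → Pt n) → ∀ i →
      0 ℕ.< sumℕ (λ i′ → inPart lab (lab (kind i)) (kind i′))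
    0<count-in-own-part kind i = ℕP.<-≤-trans (ℕP.≤-reflexive (sym (inPart-own (kind i))))
                                            (≤-sumℕ (λ i′ → inPart lab (lab (kind i)) (kind i′)) i)

  -- Regular partitions

  data Shape : Bool → ℕ → ℕ → ℕ → Set where
    x′-shape : ∀ t → Shape true t (2 ℕ.* t) 0
    x″-shape : ∀ t → Shape false t 0 (2 ℕ.* t)

  shape-of : ∀ {A B C} → (∃ λ t → (A ≡ t × B ≡ 2 ℕ.* t × C ≡ 0) ⊎ (A ≡ t × B ≡ 0 × C ≡ 2 ℕ.* t)) →
    ∃ λ b → Shape b A B C
  shape-of (t , inj₁ (refl , refl , refl)) = true , x′-shape t
  shape-of (t , inj₂ (refl , refl , refl)) = false , x″-shape t

  shape-with-x′ : ∀ {b A B C} → Shape b A B C → 0 ℕ.< B → b ≡ true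
  shape-with-x′ (x′-shape t) _ = refl

  shape-with-x″ : ∀ {b A B C} → Shape b A B C → 0 ℕ.< C → b ≡ false
  shape-with-x″ (x″-shape t) _ = refl

  shape-x′-count : ∀ {b A B C} → Shape b A B C → B ≡ 2 ℕ.* (A ℕ.* 𝟙 b)
  shape-x′-count (x′-shape t) = cong (2 ℕ.*_) (sym (ℕP.*-identityʳ t))
  shape-x′-count (x″-shape t) = cong (2 ℕ.*_) (sym (ℕP.*-zeroʳ t))

  meanWeight : ℚ → ℚ → ℚ → Bool → ℚ
  meanWeight α β γ true = (α + ℕtoℚ 2 * β) * (+ 1 / 3)
  meanWeight α β γ false = (α + ℕtoℚ 2 * γ) * (+ 1 / 3)

  shape-weight : ∀ α β γ {b A B C} → Shape b A B C →
    ℕtoℚ A * α + (ℕtoℚ B * β + ℕtoℚ C * γ) ≡ meanWeight α β γ b * ℕtoℚ (A ℕ.+ (B ℕ.+ C))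
  shape-weight α β γ (x′-shape t) rewrite ℕtoℚ-+ t (2 ℕ.* t ℕ.+ 0) | ℕtoℚ-+ (2 ℕ.* t) 0 | ℕtoℚ-* 2 t =
    solve 4 (λ α β γ T → T :* α :+ (con (ℕtoℚ 2) :* T :* β :+ con 0ℚ :* γ)
                        := (α :+ con (ℕtoℚ 2) :* β) :* con (+ 1 / 3) :* (T :+ (con (ℕtoℚ 2) :* T :+ con 0ℚ)))
      refl α β γ (ℕtoℚ t)
  shape-weight α β γ (x″-shape t) rewrite ℕtoℚ-+ t (2 ℕ.* t) | ℕtoℚ-* 2 t =
    solve 4 (λ α β γ T → T :* α :+ (con 0ℚ :* β :+ con (ℕtoℚ 2) :* T :* γ)
                        := (α :+ con (ℕtoℚ 2) :* γ) :* con (+ 1 / 3) :* (T :+ con (ℕtoℚ 2) :* T)) refl α β γ (ℕtoℚ t)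

  module RegularPartition {n m : ℕ} (lab : Pt n → Fin m) (reg : Regular lab) where

    hasX′ : Fin m → Bool
    hasX′ j = proj₁ (shape-of (reg j))

    shape : ∀ j → Shape (hasX′ j) (sigA lab j) (sigB lab j) (sigC lab j)
    shape j = proj₂ (shape-of (reg j))

    x′-in-x′-part : ∀ i → hasX′ (lab (px′ i)) ≡ true
    x′-in-x′-part i = shape-with-x′ (shape (lab (px′ i))) (0<count-in-own-part lab px′ i)

    x″-in-x″-part : ∀ i → hasX′ (lab (px″ i)) ≡ false
    x″-in-x″-part i = shape-with-x″ (shape (lab (px″ i))) (0<count-in-own-part lab px″ i)

    sumPart-byKind-regular : ∀ α β γ j →
      sumPart lab j (byKind α β γ) ≡ meanWeight α β γ (hasX′ j) * ℕtoℚ (sizePart lab j)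
    sumPart-byKind-regular α β γ j = trans (sumPart-byKind lab j α β γ) (shape-weight α β γ (shape j))

    inX′ : Fin n → Bool
    inX′ i = hasX′ (lab (px i))

    count-inX′ : n ≡ 2 ℕ.* sumℕ (𝟙 ∘ inX′)
    count-inX′ = ℕtoℚ-injective (begin
      ℕtoℚ n
        ≡⟨ sym (QP.*-identityʳ (ℕtoℚ n)) ⟩
      ℕtoℚ n * 1ℚ
        ≡⟨ sym (sumℚ-const {n} 1ℚ) ⟩
      sumℚ {n} (λ _ → 1ℚ)
        ≡⟨ sym (sum-partCount lab px′ (λ _ → 1ℚ)) ⟩
      sumℚ (λ j → ℕtoℚ (sigB lab j) * 1ℚ)
        ≡⟨ sumℚ-cong (λ j → trans (QP.*-identityʳ _) (x′-count j)) ⟩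
      sumℚ (λ j → ℕtoℚ 2 * (ℕtoℚ (sigA lab j) * ℕtoℚ (𝟙 (hasX′ j))))
        ≡⟨ sumℚ-*ˡ (ℕtoℚ 2) (λ j → ℕtoℚ (sigA lab j) * ℕtoℚ (𝟙 (hasX′ j))) ⟩
      ℕtoℚ 2 * sumℚ (λ j → ℕtoℚ (sigA lab j) * ℕtoℚ (𝟙 (hasX′ j)))
        ≡⟨ cong (ℕtoℚ 2 *_) (trans (sum-partCount lab px (ℕtoℚ ∘ 𝟙 ∘ hasX′)) (sumℚ-ℕtoℚ (𝟙 ∘ inX′))) ⟩
      ℕtoℚ 2 * ℕtoℚ (sumℕ (𝟙 ∘ inX′))
        ≡⟨ sym (ℕtoℚ-* 2 (sumℕ (𝟙 ∘ inX′))) ⟩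
      ℕtoℚ (2 ℕ.* sumℕ (𝟙 ∘ inX′))
        ∎)
      where
      open ≡-Reasoning
      x′-count : ∀ j → ℕtoℚ (sigB lab j) ≡ ℕtoℚ 2 * (ℕtoℚ (sigA lab j) * ℕtoℚ (𝟙 (hasX′ j)))
      x′-count j = begin
        ℕtoℚ (sigB lab j)                                  ≡⟨ cong ℕtoℚ (shape-x′-count (shape j)) ⟩
        ℕtoℚ (2 ℕ.* (sigA lab j ℕ.* 𝟙 (hasX′ j)))          ≡⟨ ℕtoℚ-* 2 (sigA lab j ℕ.* 𝟙 (hasX′ j)) ⟩
        ℕtoℚ 2 * ℕtoℚ (sigA lab j ℕ.* 𝟙 (hasX′ j))         ≡⟨ cong (ℕtoℚ 2 *_) (ℕtoℚ-* (sigA lab j) (𝟙 (hasX′ j))) ⟩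
        ℕtoℚ 2 * (ℕtoℚ (sigA lab j) * ℕtoℚ (𝟙 (hasX′ j)))  ∎

  -- The dual certificate

  -- N, E and C stand for n, Σ εᵢ and the number of x_i lying in x′-parts, as in certificate-sum.
  certificate-algebra : ∀ N E C K c ρ δ ε →
    N ≡ ℕtoℚ 2 * K → E ≡ 1ℚ → C ≡ K → K * δ ≡ + 1 / 4 → K * ε ≡ + 1 / 6 →
    (N * (- 1ℚ * ½) - (meanWeight (- 1ℚ) (- c) c false * (N * ½ + E)
                       + (meanWeight (- 1ℚ) (- c) c true - meanWeight (- 1ℚ) (- c) c false) * (C * ½ + ρ)))
    + (N * (- c * ½ - meanWeight (- 1ℚ) (- c) c true * (½ - δ))
       + N * (c * (½ + ε) - meanWeight (- 1ℚ) (- c) c false * ½))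
    ≡ + 1 / 6 + + 4 / 3 * (c * (ρ - ½))
  certificate-algebra _ _ _ K c ρ δ ε refl refl refl Kδ≡¼ Kε≡⅙ = begin
    _ ≡⟨ solve 5 (λ K c ρ δ ε →
           let two = con (ℕtoℚ 2) ; ⅓ = con (+ 1 / 3) ; h = con ½
               σT = (con (- 1ℚ) :+ two :* (:- c)) :* ⅓ ; σF = (con (- 1ℚ) :+ two :* c) :* ⅓ in
           (two :* K :* (con (- 1ℚ) :* h) :- (σF :* (two :* K :* h :+ con 1ℚ) :+ (σT :- σF) :* (K :* h :+ ρ)))
           :+ (two :* K :* ((:- c) :* h :- σT :* (h :- δ)) :+ two :* K :* (c :* (h :+ ε) :- σF :* h))
           := two :* c :* (K :* ε) :- σT :* (ρ :- two :* (K :* δ)) :- σF :* (con 1ℚ :- ρ)) refl K c ρ δ ε ⟩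
    ℕtoℚ 2 * c * (K * ε) - σT * (ρ - ℕtoℚ 2 * (K * δ)) - σF * (1ℚ - ρ)
      ≡⟨ cong₂ (λ u v → ℕtoℚ 2 * c * v - σT * (ρ - ℕtoℚ 2 * u) - σF * (1ℚ - ρ)) Kδ≡¼ Kε≡⅙ ⟩
    ℕtoℚ 2 * c * (+ 1 / 6) - σT * (ρ - ℕtoℚ 2 * (+ 1 / 4)) - σF * (1ℚ - ρ)
      ≡⟨ solve 2 (λ c ρ → let two = con (ℕtoℚ 2) ; ⅓ = con (+ 1 / 3)
                              σT = (con (- 1ℚ) :+ two :* (:- c)) :* ⅓ ; σF = (con (- 1ℚ) :+ two :* c) :* ⅓ in
           two :* c :* con (+ 1 / 6) :- σT :* (ρ :- two :* con (+ 1 / 4)) :- σF :* (con 1ℚ :- ρ)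
           := con (+ 1 / 6) :+ con (+ 4 / 3) :* (c :* (ρ :- con ½))) refl c ρ ⟩
    + 1 / 6 + + 4 / 3 * (c * (ρ - ½))
      ∎
    where
    open ≡-Reasoning
    σT σF : ℚ
    σT = meanWeight (- 1ℚ) (- c) c true
    σF = meanWeight (- 1ℚ) (- c) c false

  module CertificateBound (k : ℕ) (a : Fin (2 ℕ.* k) → ℕ) {m : ℕ} (lab : Pt (2 ℕ.* k) → Fin m) (reg : Regular lab)
    where
    open Instance k a
    open RegularPartition lab reg

    D : ℚ
    D = divℕ 1ℚ (3 ℕ.* n)

    instance
      D-nonNeg : Q.NonNegative D
      D-nonNeg = divℕ-nonNeg 1ℚ (3 ℕ.* n)

    ρ : ℚ
    ρ = sumℚ (λ i → ℕtoℚ (𝟙 (inX′ i)) * εᵢ i)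

    module _ (α β γ : ℚ) where

      σ : Bool → ℚ
      σ = meanWeight α β γ

      certificate : Pt n → ℚ
      certificate x = byKind α β γ x * f x - σ (hasX′ (lab x)) * μ x

      certificate≤cost : Q.∣ α ∣ Q.≤ 1ℚ → Q.∣ β ∣ Q.≤ 1ℚ → Q.∣ γ ∣ Q.≤ 1ℚ → D * sumPt certificate Q.≤ cost lab
      certificate≤cost ∣α∣≤1 ∣β∣≤1 ∣γ∣≤1 = begin
        D * sumPt certificate
          ≡⟨ sym (sumPt-*ˡ D certificate) ⟩
        sumPt (λ x → D * certificate x)
          ≡⟨ sym (sum-sumPart lab (λ j x → D * (byKind α β γ x * f x - σ (hasX′ j) * μ x))) ⟩
        sumℚ (λ j → sumPart lab j (λ x → D * (byKind α β γ x * f x - σ (hasX′ j) * μ x)))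
          ≤⟨ sumℚ-mono-≤ (λ j → weighted≤deviation lab j D (byKind α β γ) f μ (σ (hasX′ j))
                                   bounded (sumPart-byKind-regular α β γ j)) ⟩
        cost lab
          ∎
        where
        open QP.≤-Reasoning
        bounded : ∀ x → Q.∣ byKind α β γ x ∣ Q.≤ 1ℚ
        bounded (px _) = ∣α∣≤1
        bounded (px′ _) = ∣β∣≤1
        bounded (px″ _) = ∣γ∣≤1

      certificate-sum : sumPt certificate ≡
        (ℕtoℚ n * (α * ½) - (σ false * (ℕtoℚ n * ½ + sumℚ εᵢ)
                             + (σ true - σ false) * (ℕtoℚ (sumℕ (𝟙 ∘ inX′)) * ½ + ρ)))
        + (ℕtoℚ n * (β * ½ - σ true * (½ - δ)) + ℕtoℚ n * (γ * (½ + ε) - σ false * ½))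
      certificate-sum = cong₂ _+_ x-sum (cong₂ _+_ x′-sum x″-sum)
        where
        open ≡-Reasoning
        ι : Fin n → ℚ
        ι i = ℕtoℚ (𝟙 (inX′ i))
        x-sum : sumℚ (certificate ∘ px) ≡
          ℕtoℚ n * (α * ½) - (σ false * (ℕtoℚ n * ½ + sumℚ εᵢ)
                              + (σ true - σ false) * (ℕtoℚ (sumℕ (𝟙 ∘ inX′)) * ½ + ρ))
        x-sum = begin
          sumℚ (λ i → α * ½ - σ (inX′ i) * (½ + εᵢ i))
            ≡⟨ sumℚ-minus (λ _ → α * ½) (λ i → σ (inX′ i) * (½ + εᵢ i)) ⟩
          sumℚ {n} (λ _ → α * ½) - sumℚ (λ i → σ (inX′ i) * (½ + εᵢ i))
            ≡⟨ cong₂ _-_ (sumℚ-const {n} (α * ½)) (sum-select inX′ σ (λ i → ½ + εᵢ i)) ⟩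
          ℕtoℚ n * (α * ½) - (σ false * sumℚ (λ i → ½ + εᵢ i)
                              + (σ true - σ false) * sumℚ (λ i → ι i * (½ + εᵢ i)))
            ≡⟨ cong (λ s → ℕtoℚ n * (α * ½) - (σ false * s + (σ true - σ false) * sumℚ (λ i → ι i * (½ + εᵢ i))))
                    (trans (sumℚ-+ (λ _ → ½) εᵢ) (cong (_+ sumℚ εᵢ) (sumℚ-const {n} ½))) ⟩
          ℕtoℚ n * (α * ½) - (σ false * (ℕtoℚ n * ½ + sumℚ εᵢ)
                              + (σ true - σ false) * sumℚ (λ i → ι i * (½ + εᵢ i)))
            ≡⟨ cong (λ s → ℕtoℚ n * (α * ½) - (σ false * (ℕtoℚ n * ½ + sumℚ εᵢ) + (σ true - σ false) * s))
                    (trans (sumℚ-cong (λ i → QP.*-distribˡ-+ (ι i) ½ (εᵢ i)))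
                    (trans (sumℚ-+ (λ i → ι i * ½) (λ i → ι i * εᵢ i))
                           (cong (_+ ρ) (sumℚ-ℕtoℚ-* (𝟙 ∘ inX′) ½)))) ⟩
          ℕtoℚ n * (α * ½) - (σ false * (ℕtoℚ n * ½ + sumℚ εᵢ)
                              + (σ true - σ false) * (ℕtoℚ (sumℕ (𝟙 ∘ inX′)) * ½ + ρ))
            ∎
        x′-sum : sumℚ (certificate ∘ px′) ≡ ℕtoℚ n * (β * ½ - σ true * (½ - δ))
        x′-sum = trans (sumℚ-cong (λ i → cong (λ b → β * ½ - σ b * (½ - δ)) (x′-in-x′-part i)))
                       (sumℚ-const {n} (β * ½ - σ true * (½ - δ)))
        x″-sum : sumℚ (certificate ∘ px″) ≡ ℕtoℚ n * (γ * (½ + ε) - σ false * ½)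
        x″-sum = trans (sumℚ-cong (λ i → cong (λ b → γ * (½ + ε) - σ b * ½) (x″-in-x″-part i)))
                       (sumℚ-const {n} (γ * (½ + ε) - σ false * ½))

    count-inX′≡k : sumℕ (𝟙 ∘ inX′) ≡ k
    count-inX′≡k = ℕP.*-cancelˡ-≡ (sumℕ (𝟙 ∘ inX′)) k 2 (sym count-inX′)

    I : Subset n
    I = tabulate inX′

    ∣I∣≡k : ∣ I ∣ ≡ k
    ∣I∣≡k = trans (∣tabulate∣ inX′) count-inX′≡k

    ρ≡share : ρ ≡ divℕ (ℕtoℚ (sumℕ (λ i → sumIn I i a))) S
    ρ≡share = begin
      sumℚ (λ i → ℕtoℚ (𝟙 (inX′ i)) * divℕ (ℕtoℚ (a i)) S)
        ≡⟨ sumℚ-cong (λ i → trans (*-divℕ (ℕtoℚ (𝟙 (inX′ i))) (ℕtoℚ (a i)) S)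
                                  (cong (λ q → divℕ q S) (trans (sym (ℕtoℚ-* (𝟙 (inX′ i)) (a i)))
                                                                (cong ℕtoℚ (sym (sumIn-tabulate inX′ a i)))))) ⟩
      sumℚ (λ i → divℕ (ℕtoℚ (sumIn I i a)) S)
        ≡⟨ sumℚ-divℕ (λ i → ℕtoℚ (sumIn I i a)) S ⟩
      divℕ (sumℚ (λ i → ℕtoℚ (sumIn I i a))) S
        ≡⟨ cong (λ q → divℕ q S) (sumℚ-ℕtoℚ (λ i → sumIn I i a)) ⟩
      divℕ (ℕtoℚ (sumℕ (λ i → sumIn I i a))) S
        ∎
      where open ≡-Reasoning

    module _ .{{_ : NonZero k}} .{{_ : NonZero S}} where

      K : ℚ
      K = ℕtoℚ k

      ℕtoℚ-n : ℕtoℚ n ≡ ℕtoℚ 2 * K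
      ℕtoℚ-n = ℕtoℚ-* 2 k

      sum-εᵢ : sumℚ εᵢ ≡ 1ℚ
      sum-εᵢ = begin
        sumℚ (λ i → divℕ (ℕtoℚ (a i)) S)   ≡⟨ sumℚ-divℕ (ℕtoℚ ∘ a) S ⟩
        divℕ (sumℚ (ℕtoℚ ∘ a)) S           ≡⟨ cong (λ q → divℕ q S) (sumℚ-ℕtoℚ a) ⟩
        divℕ (ℕtoℚ S) S                    ≡⟨ divℕ-self S ⟩
        1ℚ                                 ∎
        where open ≡-Reasoning

      K*δ : K * δ ≡ + 1 / 4
      K*δ = ℕtoℚ-*-divℕ-* 1ℚ 4 k

      K*ε : K * ε ≡ + 1 / 6
      K*ε = ℕtoℚ-*-divℕ-* 1ℚ 6 k

      instance
        D-pos : Q.Positive D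
        D-pos = divℕ-pos 1ℚ (3 ℕ.* n) {{_}} {{ℕP.m*n≢0 3 n {{_}} {{ℕP.m*n≢0 2 k}}}}

      certificate-value : ∀ c → sumPt (certificate (- 1ℚ) (- c) c) ≡ + 1 / 6 + + 4 / 3 * (c * (ρ - ½))
      certificate-value c = trans (certificate-sum (- 1ℚ) (- c) c)
        (certificate-algebra (ℕtoℚ n) (sumℚ εᵢ) (ℕtoℚ (sumℕ (𝟙 ∘ inX′))) K c ρ δ ε
                             ℕtoℚ-n sum-εᵢ (cong ℕtoℚ count-inX′≡k) K*δ K*ε)

      1/36k<cost : ∀ c → Q.∣ c ∣ Q.≤ 1ℚ → 0ℚ Q.< c * (ρ - ½) → divℕ 1ℚ (36 ℕ.* k) Q.< cost lab
      1/36k<cost c ∣c∣≤1 gain = begin-strict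
        divℕ 1ℚ (36 ℕ.* k)
          ≡⟨ 1/36k ⟩
        + 1 / 6 * D
          <⟨ QP.*-monoˡ-<-pos D ⅙<value ⟩
        (+ 1 / 6 + + 4 / 3 * (c * (ρ - ½))) * D
          ≡⟨ trans (QP.*-comm _ D) (cong (D *_) (sym (certificate-value c))) ⟩
        D * sumPt (certificate (- 1ℚ) (- c) c)
          ≤⟨ certificate≤cost (- 1ℚ) (- c) c QP.≤-refl (subst (Q._≤ 1ℚ) (sym (QP.∣-p∣≡∣p∣ c)) ∣c∣≤1) ∣c∣≤1 ⟩
        cost lab
          ∎
        where
        open QP.≤-Reasoning
        ⅙<value : + 1 / 6 Q.< + 1 / 6 + + 4 / 3 * (c * (ρ - ½))
        ⅙<value = QP.+-monoʳ-< (+ 1 / 6) (QP.*-monoʳ-<-pos (+ 4 / 3) gain)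
        1/36k : divℕ 1ℚ (36 ℕ.* k) ≡ + 1 / 6 * D
        1/36k = begin-equality
          divℕ 1ℚ (36 ℕ.* k)             ≡⟨ cong (divℕ 1ℚ) (ℕP.*-assoc 6 6 k) ⟩
          divℕ 1ℚ (6 ℕ.* (6 ℕ.* k))      ≡⟨ divℕ-* 1ℚ 6 (6 ℕ.* k) {{_}} {{ℕP.m*n≢0 6 k}} ⟩
          divℕ (+ 1 / 6) (6 ℕ.* k)       ≡⟨ divℕ-as-* (+ 1 / 6) (6 ℕ.* k) ⟩
          + 1 / 6 * divℕ 1ℚ (6 ℕ.* k)    ≡⟨ cong (λ d → + 1 / 6 * divℕ 1ℚ d) (ℕP.*-assoc 3 2 k) ⟩
          + 1 / 6 * D                    ∎

      ρ≡½⇒balanced : ρ ≡ ½ → ℕtoℚ (sumℕ (λ i → sumIn I i a)) ≡ divℕ (ℕtoℚ S) 2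
      ρ≡½⇒balanced ρ≡½ = begin
        ℕtoℚ (sumℕ (λ i → sumIn I i a))                      ≡⟨ sym (ℕtoℚ-*-divℕ _ S) ⟩
        ℕtoℚ S * divℕ (ℕtoℚ (sumℕ (λ i → sumIn I i a))) S    ≡⟨ cong (ℕtoℚ S *_) (trans (sym ρ≡share) ρ≡½) ⟩
        ℕtoℚ S * ½                                           ∎
        where open ≡-Reasoning

      ρ≢½⇒1/36k<cost : ¬ (ρ ≡ ½) → divℕ 1ℚ (36 ℕ.* k) Q.< cost lab
      ρ≢½⇒1/36k<cost ρ≢½ = by-trichotomy (QP.<-cmp ρ ½)
        where
        by-trichotomy : Tri (ρ Q.< ½) (ρ ≡ ½) (½ Q.< ρ) → divℕ 1ℚ (36 ℕ.* k) Q.< cost lab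
        by-trichotomy (tri< ρ<½ _ _) =
          1/36k<cost (- 1ℚ) QP.≤-refl (subst (0ℚ Q.<_) (negate ½ ρ) (0<q-p ρ<½))
          where
          negate : ∀ p q → p - q ≡ - 1ℚ * (q - p)
          negate = solve 2 (λ p q → p :- q := con (- 1ℚ) :* (q :- p)) refl
        by-trichotomy (tri≈ _ ρ≡½ _) = ⊥-elim (ρ≢½ ρ≡½)
        by-trichotomy (tri> _ _ ½<ρ) =
          1/36k<cost 1ℚ QP.≤-refl (subst (0ℚ Q.<_) (sym (QP.*-identityˡ (ρ - ½))) (0<q-p ½<ρ))

open CostLowerBound using (sumℕ-nonZero; module CertificateBound)
open import Data.Nat using (ℕ; zero; suc; NonZero; _≤_; _<_; _*_)
open import Data.Fin using (Fin; zero)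
open import Data.Fin.Subset using (Subset; ∣_∣)
open import Data.Rational using (1ℚ; _+_)
open import Relation.Binary.PropositionalEquality using (_≡_)
open import Relation.Nullary using (¬_)
import Data.Rational as Q

lemma6p12 : (k : ℕ) → 1 ≤ k → (a : Fin (2 * k) → ℕ) →
    (∀ i → 0 < a i) →
    (∀ i j → ℕtoℚ (a i) Q.≤ (1ℚ + divℕ 1ℚ (100 * k)) Q.* ℕtoℚ (a j)) →
    (∀ (I : Subset (2 * k)) → ∣ I ∣ ≡ k →
      ¬ (ℕtoℚ (sumℕ (λ i → sumIn I i a)) ≡ divℕ (ℕtoℚ (sumℕ a)) 2)) →
    ∀ (m : ℕ) (lab : Pt (2 * k) → Fin m) → Regular lab →
    divℕ 1ℚ (36 * k) Q.< Instance.cost k a lab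
lemma6p12 zero () _ _ _ _ _ _ _
lemma6p12 k@(suc _) _ a a>0 _ unbalanced m lab reg =
  ρ≢½⇒1/36k<cost (λ ρ≡½ → unbalanced I ∣I∣≡k (ρ≡½⇒balanced ρ≡½))
  where
  open CertificateBound k a lab reg
  instance
    S≢0 : NonZero (sumℕ a)
    S≢0 = sumℕ-nonZero a (a>0 zero)
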